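{- For all $n \in \mathbb{Z}$ and $m, \ell \in \mathbb{N}$, $$\det \begin{pmatrix} f(n, x, s) & f(n - \ell, x, q^\ell s) \\ f(n + m, x, s) & f(n + m - \ell, x, q^\ell s) \end{pmatrix} = (-s)^{n-\ell} q^{\binom{n}{2} - \binom{\ell}{2}} f(\ell, x, s) f(m, x, q^n s).$$
   Context: Let $q,x,s$ be indeterminates. The Carlitz $q$-Fibonacci polynomials $f(n,x,s)$, $n\in\mathbb{Z}$, are the elements of $\mathbb{Q}(q,x,s)$ determined by $f(0,x,s)=0$, $f(1,x,s)=1$ and $f(n, x, s) = x f(n-1, x, s) + q^{n-2}s f(n-2, x, s)$ for all $n\in\mathbb{Z}$ (used in both directions, so $f$ is defined for negative $n$). $f(m,x,q^a s)$ means $f(m,x,t)$ with $t=q^a s$. -}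

module Defs where

open import Level using (Level)
open import Data.Nat using (ℕ; zero; suc)
open import Data.Nat.Combinatorics using (_C_)
open import Data.Integer using (ℤ; +_; -[1+_])
open import Data.Product using (_×_; _,_; proj₁; proj₂)
open import Algebra.Bundles using (CommutativeRing)

-- Everything is parametrised by a commutative ring R.  The elements
-- qi and si are intended to be inverses of q and s (this is imposed as a
-- hypothesis in the statement).

module _ {c ℓ : Level} (R : CommutativeRing c ℓ) where
  open CommutativeRing R renaming (Carrier to A)

  pow : A → ℕ → A
  pow a zero    = 1#
  pow a (suc k) = a * pow a k

  zpow : A → A → ℤ → A
  zpow a ai (+ k)      = pow a k
  zpow a ai -[1+ k ]   = pow ai (suc k)

  fpos : (q x t : A) → ℕ → A
  fpos q x t zero          = 0#
  fpos q x t (suc zero)    = 1#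
  fpos q x t (suc (suc k)) = x * fpos q x t (suc k) + pow q k * t * fpos q x t k

  -- backward: fneg k = (f(1-k), f(-k)), using
  -- f(-(k+1)) = (f(1-k) - x f(-k)) q^{k+1} t^{-1}
  fneg : (q qi x t ti : A) → ℕ → A × A
  fneg q qi x t ti zero    = 1# , 0#
  fneg q qi x t ti (suc k) =
    let p = fneg q qi x t ti k in
    proj₂ p , (proj₁ p - x * proj₂ p) * pow q (suc k) * ti

  f : (q qi x t ti : A) → ℤ → A
  f q qi x t ti (+ k)     = fpos q x t k
  f q qi x t ti -[1+ k ]  = proj₂ (fneg q qi x t ti (suc k))

-- binomial coefficient (n choose 2) = n(n-1)/2 for n ∈ ℤ
binom2 : ℤ → ℤ
binom2 (+ k)     = + (k C 2)
binom2 -[1+ k ]  = + (suc (suc k) C 2)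

-- Let a(n) = f(n, x, s) and b(n) = f(n - ℓ, x, qˡ s).  Both solve the
-- recurrence u(n+2) = x u(n+1) + qⁿ s u(n), so for fixed n the determinant
-- D(m) = a(n) b(n+m) - b(n) a(n+m) solves the same recurrence in m with
-- coefficient q^m (qⁿ s); as D(0) = 0 this forces D(m) = D(1) f(m, x, qⁿ s).
-- The Casoratian W(n) = D(1) satisfies W(n+1) = -qⁿ s W(n), and W(ℓ) = f(ℓ)
-- because b(ℓ) = 0 and b(ℓ+1) = 1; solving this first-order recurrence in
-- both directions from n = ℓ produces the factor (-s)^{n-ℓ} q^{C(n,2) - C(ℓ,2)}.
module Submission where

open import Defs
open import Data.Nat using (ℕ)
open import Data.Integer using (ℤ; +_) renaming (_+_ to _+ℤ_; _-_ to _-ℤ_)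
open import Algebra.Bundles using (CommutativeRing)

open import Level using (Level)
import Data.Nat as ℕ
open import Data.Nat.Combinatorics using (_C_; nC1≡n; nCk+nC[k+1]≡[n+1]C[k+1])
open import Data.Integer using (-[1+_]; 0ℤ; 1ℤ) renaming (suc to sucℤ; -_ to -ℤ_)
import Data.Integer.Properties as ℤₚ
open import Data.Integer.Tactic.RingSolver using (solve-∀)
open import Data.Product using (proj₁; proj₂)
import Relation.Binary.PropositionalEquality as ≡
open ≡ using (_≡_)

-- Written with 1ℤ +ℤ_ (definitionally sucℤ) because the reflective solver cannot see through sucℤ.
i+[1+j]≡1+[i+j] : ∀ i j → i +ℤ (1ℤ +ℤ j) ≡ 1ℤ +ℤ (i +ℤ j)
i+[1+j]≡1+[i+j] = solve-∀

[1+i]-j≡1+[i-j] : ∀ i j → 1ℤ +ℤ i -ℤ j ≡ 1ℤ +ℤ (i -ℤ j)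
[1+i]-j≡1+[i-j] = solve-∀

i-j+j≡i : ∀ i j → i -ℤ j +ℤ j ≡ i
i-j+j≡i = solve-∀

i+[j-i]≡j : ∀ i j → i +ℤ (j -ℤ i) ≡ j
i+[j-i]≡j = solve-∀

[1+i]-i≡1 : ∀ i → 1ℤ +ℤ i -ℤ i ≡ 1ℤ
[1+i]-i≡1 = solve-∀

-i+[i+j]≡j : ∀ i j → -ℤ i +ℤ (i +ℤ j) ≡ j
-i+[i+j]≡j = solve-∀

ℤ-induction : ∀ {p} (P : ℤ → Set p) → P 0ℤ →
  (∀ i → P i → P (sucℤ i)) → (∀ i → P (sucℤ i) → P i) → ∀ n → P n
ℤ-induction P P0 up down (+ ℕ.zero)        = P0
ℤ-induction P P0 up down (+ ℕ.suc k)       = up (+ k) (ℤ-induction P P0 up down (+ k))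
ℤ-induction P P0 up down -[1+ ℕ.zero ]     = down -[1+ 0 ] P0
ℤ-induction P P0 up down -[1+ ℕ.suc k ]    = down -[1+ ℕ.suc k ] (ℤ-induction P P0 up down -[1+ k ])

ℤ-induction-from : ∀ {p} (P : ℤ → Set p) (b : ℤ) → P b →
  (∀ i → P i → P (sucℤ i)) → (∀ i → P (sucℤ i) → P i) → ∀ n → P n
ℤ-induction-from P b Pb up down n =
  ≡.subst P (i+[j-i]≡j b n) (ℤ-induction (λ d → P (b +ℤ d)) P0 up′ down′ (n -ℤ b))
  where
  P0 : P (b +ℤ 0ℤ)
  P0 = ≡.subst P (≡.sym (ℤₚ.+-identityʳ b)) Pb
  up′ : ∀ i → P (b +ℤ i) → P (b +ℤ sucℤ i)
  up′ i h = ≡.subst P (≡.sym (i+[1+j]≡1+[i+j] b i)) (up _ h)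
  down′ : ∀ i → P (b +ℤ sucℤ i) → P (b +ℤ i)
  down′ i h = down _ (≡.subst P (i+[1+j]≡1+[i+j] b i) h)

suc[n]C2≡n+nC2 : ∀ n → ℕ.suc n C 2 ≡ n ℕ.+ n C 2
suc[n]C2≡n+nC2 n =
  ≡.trans (≡.sym (nCk+nC[k+1]≡[n+1]C[k+1] n 1))
          (≡.cong (ℕ._+ n C 2) (nC1≡n n))

binom2-suc : ∀ n → binom2 (sucℤ n) ≡ n +ℤ binom2 n
binom2-suc (+ k)                = ≡.cong +_ (suc[n]C2≡n+nC2 k)
binom2-suc -[1+ ℕ.zero ]        = ≡.refl
binom2-suc -[1+ ℕ.suc j ]       = ≡.sym (≡.trans
  (≡.cong (λ k → -[1+ ℕ.suc j ] +ℤ + k) (suc[n]C2≡n+nC2 (ℕ.suc (ℕ.suc j))))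
  (-i+[i+j]≡j (+ ℕ.suc (ℕ.suc j)) (+ (ℕ.suc (ℕ.suc j) C 2))))

module _ {c ℓ : Level} (R : CommutativeRing c ℓ) where
  open CommutativeRing R renaming (Carrier to A)
  open import Algebra.Properties.Ring ring
    using ( -‿distribˡ-*; -‿distribʳ-*; -‿involutive; -‿+-comm; ⁻¹-anti-homo‿-
          ; xyx⁻¹≈y; x[y-z]≈xy-xz; -0#≈0#)
  open import Algebra.Solver.Ring.NaturalCoefficients.Default commutativeSemiring
  open import Relation.Binary.Reasoning.Setoid setoid

  -x*-y≈x*y : ∀ a b → - a * - b ≈ a * b
  -x*-y≈x*y a b = begin
    - a * - b     ≈⟨ sym (-‿distribˡ-* a (- b)) ⟩
    - (a * - b)   ≈⟨ -‿cong (sym (-‿distribʳ-* a b)) ⟩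
    - - (a * b)   ≈⟨ -‿involutive (a * b) ⟩
    a * b         ∎

  x+[y-x]≈y : ∀ a b → a + (b - a) ≈ b
  x+[y-x]≈y a b = trans (sym (+-assoc a b (- a))) (xyx⁻¹≈y a b)

  [x+y]-[u+v]≈[x-u]+[y-v] : ∀ a b u v → (a + b) - (u + v) ≈ (a - u) + (b - v)
  [x+y]-[u+v]≈[x-u]+[y-v] a b u v = begin
    (a + b) + - (u + v)     ≈⟨ +-congˡ (sym (-‿+-comm u v)) ⟩
    (a + b) + (- u + - v)   ≈⟨ solve 4 (λ a b u v → (a :+ b) :+ (u :+ v) := (a :+ u) :+ (b :+ v))
                                       refl a b (- u) (- v) ⟩
    (a + - u) + (b + - v)   ∎

  *-inverse-cancel : ∀ {a ai} → a * ai ≈ 1# → ∀ y → a * (ai * y) ≈ y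
  *-inverse-cancel {a} {ai} inv y =
    trans (sym (*-assoc a ai y)) (trans (*-congʳ inv) (*-identityˡ y))

  *-inverse : ∀ {a ai b bi} → a * ai ≈ 1# → b * bi ≈ 1# → (a * b) * (ai * bi) ≈ 1#
  *-inverse {a} {ai} {b} {bi} inva invb = begin
    (a * b) * (ai * bi)   ≈⟨ solve 4 (λ a b ai bi → (a :* b) :* (ai :* bi) := (a :* ai) :* (b :* bi))
                                     refl a b ai bi ⟩
    (a * ai) * (b * bi)   ≈⟨ *-cong inva invb ⟩
    1# * 1#               ≈⟨ *-identityʳ 1# ⟩
    1#                    ∎

  pow-inverse : ∀ {a ai} → a * ai ≈ 1# → ∀ k → pow R a k * pow R ai k ≈ 1#
  pow-inverse inv ℕ.zero    = *-identityʳ 1#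
  pow-inverse inv (ℕ.suc k) = *-inverse inv (pow-inverse inv k)

  unit-recurrence-unique : (κ κi : ℤ → A) → (∀ i → κ i * κi i ≈ 1#) →
    ∀ {u v : ℤ → A} → (∀ i → u (sucℤ i) ≈ κ i * u i) → (∀ i → v (sucℤ i) ≈ κ i * v i) →
    ∀ b → u b ≈ v b → ∀ n → u n ≈ v n
  unit-recurrence-unique κ κi inv {u} {v} u-suc v-suc b ub≈vb =
    ℤ-induction-from (λ i → u i ≈ v i) b ub≈vb up down
    where
    up : ∀ i → u i ≈ v i → u (sucℤ i) ≈ v (sucℤ i)
    up i h = trans (u-suc i) (trans (*-congˡ h) (sym (v-suc i)))
    down : ∀ i → u (sucℤ i) ≈ v (sucℤ i) → u i ≈ v i
    down i h = begin
      u i                ≈⟨ sym (*-inverse-cancel inv′ (u i)) ⟩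
      κi i * (κ i * u i) ≈⟨ *-congˡ (trans (sym (u-suc i)) (trans h (v-suc i))) ⟩
      κi i * (κ i * v i) ≈⟨ *-inverse-cancel inv′ (v i) ⟩
      v i                ∎
      where
      inv′ : κi i * κ i ≈ 1#
      inv′ = trans (*-comm (κi i) (κ i)) (inv i)

  module _ {a ai : A} (inv : a * ai ≈ 1#) where

    zpow-suc : ∀ n → zpow R a ai (sucℤ n) ≈ a * zpow R a ai n
    zpow-suc (+ k)                = refl
    zpow-suc -[1+ ℕ.zero ]        = sym (trans (*-congˡ (*-identityʳ ai)) inv)
    zpow-suc -[1+ ℕ.suc k ]       = sym (*-inverse-cancel inv (pow R ai (ℕ.suc k)))

    zpow-inverse : ∀ n → zpow R a ai n * zpow R ai a n ≈ 1#
    zpow-inverse (+ k)    = pow-inverse inv k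
    zpow-inverse -[1+ k ] = pow-inverse (trans (*-comm ai a) inv) (ℕ.suc k)

    zpow-+ : ∀ i j → zpow R a ai (i +ℤ j) ≈ zpow R a ai i * zpow R a ai j
    zpow-+ i j = unit-recurrence-unique (λ _ → a) (λ _ → ai) (λ _ → inv) lhs-suc rhs-suc 0ℤ base i
      where
      lhs-suc : ∀ i → zpow R a ai (sucℤ i +ℤ j) ≈ a * zpow R a ai (i +ℤ j)
      lhs-suc i = trans (reflexive (≡.cong (zpow R a ai) (ℤₚ.+-assoc 1ℤ i j))) (zpow-suc (i +ℤ j))
      rhs-suc : ∀ i → zpow R a ai (sucℤ i) * zpow R a ai j ≈ a * (zpow R a ai i * zpow R a ai j)
      rhs-suc i = trans (*-congʳ (zpow-suc i)) (*-assoc a _ _)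
      base : zpow R a ai (0ℤ +ℤ j) ≈ zpow R a ai 0ℤ * zpow R a ai j
      base = trans (reflexive (≡.cong (zpow R a ai) (ℤₚ.+-identityˡ j))) (sym (*-identityˡ _))

  det₂ : A → A → A → A → A
  det₂ a b c d = a * d - b * c

  det₂-cong : ∀ {a a′ b b′ c c′ d d′} → a ≈ a′ → b ≈ b′ → c ≈ c′ → d ≈ d′ →
    det₂ a b c d ≈ det₂ a′ b′ c′ d′
  det₂-cong a≈ b≈ c≈ d≈ = +-cong (*-cong a≈ d≈) (-‿cong (*-cong b≈ c≈))

  det₂-self : ∀ a b → det₂ a b a b ≈ 0#
  det₂-self a b = trans (+-congˡ (-‿cong (*-comm b a))) (-‿inverseʳ (a * b))

  det₂-swap : ∀ a b c d → det₂ c d a b ≈ - det₂ a b c d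
  det₂-swap a b c d = begin
    c * b - d * a     ≈⟨ +-cong (*-comm c b) (-‿cong (*-comm d a)) ⟩
    b * c - a * d     ≈⟨ sym (⁻¹-anti-homo‿- (a * d) (b * c)) ⟩
    - (a * d - b * c) ∎

  det₂-linearʳ : ∀ a b x k c₁ d₁ c₀ d₀ →
    det₂ a b (x * c₁ + k * c₀) (x * d₁ + k * d₀) ≈ x * det₂ a b c₁ d₁ + k * det₂ a b c₀ d₀
  det₂-linearʳ a b x k c₁ d₁ c₀ d₀ = begin
    a * (x * d₁ + k * d₀) - b * (x * c₁ + k * c₀)
      ≈⟨ +-cong (expand a d₁ d₀) (-‿cong (expand b c₁ c₀)) ⟩
    (x * (a * d₁) + k * (a * d₀)) - (x * (b * c₁) + k * (b * c₀))
      ≈⟨ [x+y]-[u+v]≈[x-u]+[y-v] _ _ _ _ ⟩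
    (x * (a * d₁) - x * (b * c₁)) + (k * (a * d₀) - k * (b * c₀))
      ≈⟨ sym (+-cong (x[y-z]≈xy-xz x _ _) (x[y-z]≈xy-xz k _ _)) ⟩
    x * det₂ a b c₁ d₁ + k * det₂ a b c₀ d₀ ∎
    where
    expand : ∀ e y₁ y₀ → e * (x * y₁ + k * y₀) ≈ x * (e * y₁) + k * (e * y₀)
    expand e y₁ y₀ =
      solve 5 (λ x k e y₁ y₀ → e :* (x :* y₁ :+ k :* y₀) := x :* (e :* y₁) :+ k :* (e :* y₀))
        refl x k e y₁ y₀

  det₂-step : ∀ a₀ b₀ a₁ b₁ x k →
    det₂ a₁ b₁ (x * a₁ + k * a₀) (x * b₁ + k * b₀) ≈ - k * det₂ a₀ b₀ a₁ b₁
  det₂-step a₀ b₀ a₁ b₁ x k = begin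
    det₂ a₁ b₁ (x * a₁ + k * a₀) (x * b₁ + k * b₀)
      ≈⟨ det₂-linearʳ a₁ b₁ x k a₁ b₁ a₀ b₀ ⟩
    x * det₂ a₁ b₁ a₁ b₁ + k * det₂ a₁ b₁ a₀ b₀
      ≈⟨ +-cong (trans (*-congˡ (det₂-self a₁ b₁)) (zeroʳ x)) (*-congˡ (det₂-swap a₀ b₀ a₁ b₁)) ⟩
    0# + k * - det₂ a₀ b₀ a₁ b₁
      ≈⟨ +-identityˡ _ ⟩
    k * - det₂ a₀ b₀ a₁ b₁
      ≈⟨ sym (-‿distribʳ-* k _) ⟩
    - (k * det₂ a₀ b₀ a₁ b₁)
      ≈⟨ -‿distribˡ-* k _ ⟩
    - k * det₂ a₀ b₀ a₁ b₁ ∎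

  module Carlitz (q qi x : A) (q-inv : q * qi ≈ 1#) where

    Q : ℤ → A
    Q = zpow R q qi

    IsCarlitzSolution : A → (ℤ → A) → Set ℓ
    IsCarlitzSolution t u = ∀ n → u (sucℤ (sucℤ n)) ≈ x * u (sucℤ n) + Q n * t * u n

    fpos-unique : ∀ {t} (u : ℕ → A) → u 0 ≈ 0# →
      (∀ m → u (ℕ.suc (ℕ.suc m)) ≈ x * u (ℕ.suc m) + pow R q m * t * u m) →
      ∀ m → u m ≈ u 1 * fpos R q x t m
    fpos-unique u u0 u-rec ℕ.zero             = trans u0 (sym (zeroʳ (u 1)))
    fpos-unique u u0 u-rec (ℕ.suc ℕ.zero)     = sym (*-identityʳ (u 1))
    fpos-unique {t} u u0 u-rec (ℕ.suc (ℕ.suc m)) = begin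
      u (ℕ.suc (ℕ.suc m))
        ≈⟨ u-rec m ⟩
      x * u (ℕ.suc m) + k * u m
        ≈⟨ +-cong (*-congˡ (fpos-unique u u0 u-rec (ℕ.suc m)))
                  (*-congˡ (fpos-unique u u0 u-rec m)) ⟩
      x * (u 1 * fpos R q x t (ℕ.suc m)) + k * (u 1 * fpos R q x t m)
        ≈⟨ solve 5 (λ x k w f₁ f₀ → x :* (w :* f₁) :+ k :* (w :* f₀) := w :* (x :* f₁ :+ k :* f₀))
                   refl x k (u 1) (fpos R q x t (ℕ.suc m)) (fpos R q x t m) ⟩
      u 1 * fpos R q x t (ℕ.suc (ℕ.suc m)) ∎
      where
      k : A
      k = pow R q m * t

    f-backward-step : ∀ {t ti} → t * ti ≈ 1# → ∀ k →
      x * proj₂ (fneg R q qi x t ti k)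
        + pow R qi (ℕ.suc k) * t * proj₂ (fneg R q qi x t ti (ℕ.suc k))
        ≈ proj₁ (fneg R q qi x t ti k)
    f-backward-step {t} {ti} t-inv k = begin
      x * v + pow R qi (ℕ.suc k) * t * (w * pow R q (ℕ.suc k) * ti)
        ≈⟨ +-congˡ (solve 5 (λ qi′ t w q′ ti → qi′ :* t :* (w :* q′ :* ti)
                                              := w :* ((q′ :* t) :* (qi′ :* ti)))
                            refl (pow R qi (ℕ.suc k)) t w (pow R q (ℕ.suc k)) ti) ⟩
      x * v + w * ((pow R q (ℕ.suc k) * t) * (pow R qi (ℕ.suc k) * ti))
        ≈⟨ +-congˡ (trans (*-congˡ (*-inverse (pow-inverse q-inv (ℕ.suc k)) t-inv))
                          (*-identityʳ w)) ⟩
      x * v + w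
        ≈⟨ x+[y-x]≈y (x * v) u ⟩
      u ∎
      where
      u v w : A
      u = proj₁ (fneg R q qi x t ti k)
      v = proj₂ (fneg R q qi x t ti k)
      w = u - x * v

    f-isCarlitzSolution : ∀ {t ti} → t * ti ≈ 1# → IsCarlitzSolution t (f R q qi x t ti)
    f-isCarlitzSolution t-inv (+ k)                     = refl
    f-isCarlitzSolution t-inv -[1+ ℕ.zero ]             = sym (f-backward-step t-inv 0)
    f-isCarlitzSolution t-inv -[1+ ℕ.suc ℕ.zero ]       = sym (f-backward-step t-inv 1)
    f-isCarlitzSolution t-inv -[1+ ℕ.suc (ℕ.suc k) ]    = sym (f-backward-step t-inv (ℕ.suc (ℕ.suc k)))

    Q-shift : ∀ {t} n l → Q (n -ℤ + l) * (pow R q l * t) ≈ Q n * t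
    Q-shift {t} n l = begin
      Q (n -ℤ + l) * (pow R q l * t)  ≈⟨ sym (*-assoc _ _ t) ⟩
      Q (n -ℤ + l) * Q (+ l) * t      ≈⟨ *-congʳ (sym (zpow-+ q-inv (n -ℤ + l) (+ l))) ⟩
      Q (n -ℤ + l +ℤ + l) * t         ≈⟨ *-congʳ (reflexive (≡.cong Q (i-j+j≡i n (+ l)))) ⟩
      Q n * t                         ∎

    shift-isCarlitzSolution : ∀ {t u} l → IsCarlitzSolution (pow R q l * t) u →
      IsCarlitzSolution t (λ n → u (n -ℤ + l))
    shift-isCarlitzSolution {t} {u} l u-sol n = begin
      u (sucℤ (sucℤ n) -ℤ + l)
        ≈⟨ reflexive (≡.cong u (≡.trans ([1+i]-j≡1+[i-j] (sucℤ n) (+ l))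
                                        (≡.cong sucℤ ([1+i]-j≡1+[i-j] n (+ l))))) ⟩
      u (sucℤ (sucℤ (n -ℤ + l)))
        ≈⟨ u-sol (n -ℤ + l) ⟩
      x * u (sucℤ (n -ℤ + l)) + Q (n -ℤ + l) * (pow R q l * t) * u (n -ℤ + l)
        ≈⟨ +-cong (*-congˡ (reflexive (≡.cong u (≡.sym ([1+i]-j≡1+[i-j] n (+ l))))))
                  (*-congʳ (Q-shift n l)) ⟩
      x * u (sucℤ n -ℤ + l) + Q n * t * u (n -ℤ + l) ∎

    casoratian : (ℤ → A) → (ℤ → A) → ℤ → A
    casoratian a b n = det₂ (a n) (b n) (a (sucℤ n)) (b (sucℤ n))

    casoratian-suc : ∀ {t a b} → IsCarlitzSolution t a → IsCarlitzSolution t b →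
      ∀ n → casoratian a b (sucℤ n) ≈ - (Q n * t) * casoratian a b n
    casoratian-suc {t} {a} {b} a-sol b-sol n =
      trans (det₂-cong refl refl (a-sol n) (b-sol n))
            (det₂-step (a n) (b n) (a (sucℤ n)) (b (sucℤ n)) x (Q n * t))

    det₂≈casoratian*fpos : ∀ {t a b} → IsCarlitzSolution t a → IsCarlitzSolution t b → ∀ n m →
      det₂ (a n) (b n) (a (n +ℤ + m)) (b (n +ℤ + m)) ≈ casoratian a b n * fpos R q x (Q n * t) m
    det₂≈casoratian*fpos {t} {a} {b} a-sol b-sol n m =
      trans (fpos-unique (λ m → D (n +ℤ + m)) D₀ D-rec m)
            (*-congʳ (reflexive (≡.cong D (ℤₚ.+-comm n 1ℤ))))
      where
      D : ℤ → A
      D i = det₂ (a n) (b n) (a i) (b i)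
      D₀ : D (n +ℤ + 0) ≈ 0#
      D₀ = trans (reflexive (≡.cong D (ℤₚ.+-identityʳ n))) (det₂-self (a n) (b n))
      D-rec : ∀ m → D (n +ℤ + ℕ.suc (ℕ.suc m))
                      ≈ x * D (n +ℤ + ℕ.suc m) + pow R q m * (Q n * t) * D (n +ℤ + m)
      D-rec m = begin
        D (n +ℤ + ℕ.suc (ℕ.suc m))
          ≈⟨ reflexive (≡.cong D (≡.trans (i+[1+j]≡1+[i+j] n (+ ℕ.suc m))
                                          (≡.cong sucℤ (i+[1+j]≡1+[i+j] n (+ m))))) ⟩
        D (sucℤ (sucℤ N))
          ≈⟨ det₂-cong refl refl (a-sol N) (b-sol N) ⟩
        det₂ (a n) (b n) (x * a (sucℤ N) + Q N * t * a N) (x * b (sucℤ N) + Q N * t * b N)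
          ≈⟨ det₂-linearʳ (a n) (b n) x (Q N * t) _ _ _ _ ⟩
        x * D (sucℤ N) + Q N * t * D N
          ≈⟨ +-cong (*-congˡ (reflexive (≡.cong D (≡.sym (i+[1+j]≡1+[i+j] n (+ m))))))
                    (*-congʳ coefficient) ⟩
        x * D (n +ℤ + ℕ.suc m) + pow R q m * (Q n * t) * D N ∎
        where
        N : ℤ
        N = n +ℤ + m
        coefficient : Q N * t ≈ pow R q m * (Q n * t)
        coefficient = trans (*-congʳ (trans (zpow-+ q-inv n (+ m)) (*-comm (Q n) (pow R q m))))
                            (*-assoc (pow R q m) (Q n) t)

    module Determinant (s si : A) (s-inv : s * si ≈ 1#) (l : ℕ) where

      a b : ℤ → A
      a = f R q qi x s si
      b n = f R q qi x (pow R q l * s) (pow R qi l * si) (n -ℤ + l)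

      a-sol : IsCarlitzSolution s a
      a-sol = f-isCarlitzSolution s-inv

      b-sol : IsCarlitzSolution s b
      b-sol = shift-isCarlitzSolution l (f-isCarlitzSolution (*-inverse (pow-inverse q-inv l) s-inv))

      prefactor : ℤ → A
      prefactor n = zpow R (- s) (- si) (n -ℤ + l) * Q (binom2 n -ℤ binom2 (+ l))

      prefactor-suc : ∀ n → prefactor (sucℤ n) ≈ - (Q n * s) * prefactor n
      prefactor-suc n = begin
        zpow R (- s) (- si) (sucℤ n -ℤ + l) * Q (binom2 (sucℤ n) -ℤ binom2 (+ l))
          ≈⟨ *-cong (trans (reflexive (≡.cong (zpow R (- s) (- si)) ([1+i]-j≡1+[i-j] n (+ l))))
                           (zpow-suc (trans (-x*-y≈x*y s si) s-inv) (n -ℤ + l)))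
                    (trans (reflexive (≡.cong Q binom-index)) (zpow-+ q-inv n _)) ⟩
        (- s * z) * (Q n * β)      ≈⟨ *-congʳ (sym (-‿distribˡ-* s z)) ⟩
        - (s * z) * (Q n * β)      ≈⟨ sym (-‿distribˡ-* (s * z) _) ⟩
        - ((s * z) * (Q n * β))    ≈⟨ -‿cong (solve 4 (λ s z qn β → (s :* z) :* (qn :* β) := (qn :* s) :* (z :* β))
                                                      refl s z (Q n) β) ⟩
        - ((Q n * s) * (z * β))    ≈⟨ -‿distribˡ-* (Q n * s) _ ⟩
        - (Q n * s) * prefactor n  ∎
        where
        z β : A
        z = zpow R (- s) (- si) (n -ℤ + l)
        β = Q (binom2 n -ℤ binom2 (+ l))
        binom-index : binom2 (sucℤ n) -ℤ binom2 (+ l) ≡ n +ℤ (binom2 n -ℤ binom2 (+ l))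
        binom-index = ≡.trans (≡.cong (_-ℤ binom2 (+ l)) (binom2-suc n)) (ℤₚ.+-assoc n _ _)

      prefactor-l : prefactor (+ l) ≈ 1#
      prefactor-l = trans (*-cong (reflexive (≡.cong (zpow R (- s) (- si)) (ℤₚ.+-inverseʳ (+ l))))
                                  (reflexive (≡.cong Q (ℤₚ.+-inverseʳ (binom2 (+ l))))))
                          (*-identityʳ 1#)

      casoratian-l : casoratian a b (+ l) ≈ fpos R q x s l
      casoratian-l = begin
        casoratian a b (+ l)
          ≈⟨ det₂-cong refl (reflexive (≡.cong b′ (ℤₚ.+-inverseʳ (+ l)))) refl
                            (reflexive (≡.cong b′ ([1+i]-i≡1 (+ l)))) ⟩
        fpos R q x s l * 1# - 0# * a (sucℤ (+ l))
          ≈⟨ +-cong (*-identityʳ _) (trans (-‿cong (zeroˡ _)) -0#≈0#) ⟩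
        fpos R q x s l + 0#
          ≈⟨ +-identityʳ _ ⟩
        fpos R q x s l ∎
        where
        b′ : ℤ → A
        b′ = f R q qi x (pow R q l * s) (pow R qi l * si)

      casoratian≈prefactor : ∀ n → casoratian a b n ≈ prefactor n * fpos R q x s l
      casoratian≈prefactor =
        unit-recurrence-unique (λ i → - (Q i * s)) (λ i → - (zpow R qi q i * si)) unit
          (casoratian-suc a-sol b-sol)
          (λ i → trans (*-congʳ (prefactor-suc i)) (*-assoc _ _ _))
          (+ l)
          (trans casoratian-l (sym (trans (*-congʳ prefactor-l) (*-identityˡ _))))
        where
        unit : ∀ i → - (Q i * s) * - (zpow R qi q i * si) ≈ 1#
        unit i = trans (-x*-y≈x*y _ _) (*-inverse (zpow-inverse q-inv i) s-inv)

lemma1 : ∀ {c ℓ'} (R : CommutativeRing c ℓ') →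
    let open CommutativeRing R in
    (q qi x s si : Carrier) → q * qi ≈ 1# → s * si ≈ 1# →
    (n : ℤ) (m l : ℕ) →
    (f R q qi x s si n
       * f R q qi x (pow R q l * s) (pow R qi l * si) (n +ℤ + m -ℤ + l)
     - f R q qi x (pow R q l * s) (pow R qi l * si) (n -ℤ + l)
       * f R q qi x s si (n +ℤ + m))
    ≈ zpow R (- s) (- si) (n -ℤ + l)
      * zpow R q qi (binom2 n -ℤ binom2 (+ l))
      * f R q qi x s si (+ l)
      * f R q qi x (zpow R q qi n * s) (zpow R qi q n * si) (+ m)
lemma1 R q qi x s si q-inv s-inv n m l =
  trans (det₂≈casoratian*fpos a-sol b-sol n m) (*-congʳ (casoratian≈prefactor n))
  where
  open CommutativeRing R using (trans; *-congʳ)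
  open Carlitz R q qi x q-inv
  open Determinant s si s-inv l
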